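{- Let $G$ and $H$ be graphs. Let $k=k_1+\cdots+k_l$ with positive integers $k_i$, and index colors as pairs $(i,j)$ with $i\in\{1,\ldots,l\}$, $j\in\{1,\ldots,k_i\}$ (the second index taken modulo $k_i$). Let $g$ be a perfect $k$-coloring of $G$ whose quotient matrix has block form $$S=\begin{pmatrix}A_{1,1}&A_{1,2}&\cdots&A_{1,l}\\ \vdots&&&\vdots\\ A_{l,1}&A_{l,2}&\cdots&A_{l,l}\end{pmatrix},$$ where each $A_{i,i}$ is an equal-diagonal $k_i\times k_i$ matrix and, for $i\ne j$, $A_{i,j}=a_{i,j}J_{k_i\times k_j}$ for some integer $a_{i,j}$. For each $i$ let $h_i$ be a perfect $k_i$-coloring of $H$ with equal-diagonal quotient matrix $B_i$. Then there is a perfect coloring of $G\times H$ with quotient matrix $$\begin{pmatrix}A_{1,1}+B_1&A_{1,2}&\cdots&A_{1,l}\\ A_{2,1}&A_{2,2}+B_2&\cdots&A_{2,l}\\ \vdots&&\ddots&\vdots\\ A_{l,1}&A_{l,2}&\cdots&A_{l,l}+B_l\end{pmatrix}.$$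
   Context: $G\times H$ denotes the Cartesian product: vertices $(x,y)$, with $(x,y)$ adjacent to $(x',y')$ iff either $x=x'$ and $y,y'$ adjacent in $H$, or $y=y'$ and $x,x'$ adjacent in $G$. A $k$-coloring is a surjective map onto a $k$-element set of colors; it is perfect with quotient matrix $S=(s_{ij})$ if every vertex of color $i$ has exactly $s_{ij}$ neighbours of color $j$. An $t\times t$ matrix $M=(m_{i,j})$ is equal-diagonal if $m_{i,j}=m_{i+1,j+1}$ for all $i,j$, indices taken modulo $t$. $J_{p\times q}$ is the all-ones $p\times q$ matrix. -}

module Defs where

open import Data.Nat using (ℕ; suc; _+_; _<_)
open import Data.Nat.DivMod using (_%_; m%n<n)
open import Data.Fin using (Fin; toℕ; fromℕ<) renaming (_≟_ to _≟F_)
open import Data.List using (List; length; filter; map; _++_)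
open import Data.List.Membership.Propositional using (_∈_; _∉_)
open import Data.List.Relation.Unary.Unique.Propositional using (Unique)
open import Data.Product using (Σ; _×_; _,_; ∃)
open import Data.Product.Properties using (≡-dec)
open import Function.Definitions using (Surjective)
open import Relation.Binary.Definitions using (DecidableEquality)
open import Relation.Binary.PropositionalEquality using (_≡_; refl)
open import Relation.Nullary using (yes; no; ¬_)

record Graph : Set₁ where
  field
    V         : Set
    nbrs      : V → List V
    unique    : ∀ v → Unique (nbrs v)
    loopless  : ∀ v → v ∉ nbrs v
    symmetric : ∀ u v → u ∈ nbrs v → v ∈ nbrs u
open Graph public

prodNbrs : (G H : Graph) → V G × V H → List (V G × V H)
prodNbrs G H (x , y) =
  map (λ y' → (x , y')) (nbrs H y) ++ map (λ x' → (x' , y)) (nbrs G x)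

countCol : {A C : Set} → DecidableEquality C → (A → C) → C → List A → ℕ
countCol _≟_ c j xs = length (filter (λ u → c u ≟ j) xs)

IsPerfectColoring : {V C : Set} → (V → List V) → DecidableEquality C →
                    (V → C) → (C → C → ℕ) → Set
IsPerfectColoring {V} {C} nb _≟_ c S =
  Surjective _≡_ _≡_ c × (∀ v j → countCol _≟_ c j (nb v) ≡ S (c v) j)

sucMod : ∀ {t} → Fin t → Fin t
sucMod {suc t} i = fromℕ< (m%n<n (suc (toℕ i)) (suc t))

EqualDiagonal : ∀ {t} → (Fin t → Fin t → ℕ) → Set
EqualDiagonal {t} m = ∀ i j → m i j ≡ m (sucMod i) (sucMod j)

Col : ∀ {l} → (Fin l → ℕ) → Set
Col {l} ks = Σ (Fin l) (λ i → Fin (ks i))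

_≟Col_ : ∀ {l} {ks : Fin l → ℕ} → DecidableEquality (Col ks)
_≟Col_ = ≡-dec _≟F_ _≟F_

Block : ∀ {l} (ks : Fin l → ℕ) → (Col ks → Col ks → ℕ) →
        (i i' : Fin l) → Fin (ks i) → Fin (ks i') → ℕ
Block ks S i i' j j' = S (i , j) (i' , j')

addDiag : ∀ {l} (ks : Fin l → ℕ) → (Col ks → Col ks → ℕ) →
          ((i : Fin l) → Fin (ks i) → Fin (ks i) → ℕ) →
          Col ks → Col ks → ℕ
addDiag ks S B (i , j) (i' , j') with i ≟F i'
... | yes refl = S (i , j) (i , j') + B i j j'
... | no _     = S (i , j) (i' , j')

-- Colour (x , y) by (i , j + h_i y) when g x = (i , j), the second index of block i read in ℤ/k_i.
-- Along an edge of G the vertex y is fixed, and rotating each block of colours by its own amount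
-- is an automorphism of S: diagonal blocks are equal-diagonal, the others constant. Along an edge
-- of H the block i is fixed and y ↦ j + h_i y is a rotation of h_i, hence perfect with quotient B_i,
-- since B_i is equal-diagonal; colours of other blocks do not occur there. The two counts add up to
-- the entries of the block matrix with B_i added on the diagonal.
module Submission where

open import Defs
open import Data.Nat using (ℕ; zero; suc; _+_; _∸_; _<_)
open import Data.Nat.Properties using (+-comm; +-suc; +-identityʳ; m+[n∸m]≡n; <⇒≤)
open import Data.Nat.DivMod using (_%_; m%n<n; m<n⇒m%n≡m; m%n%n≡m%n; %-distribˡ-+; [m+n]%n≡m%n)
open import Data.Fin using (Fin; toℕ) renaming (_≟_ to _≟F_)
open import Data.Fin.Properties using (toℕ-fromℕ<; toℕ-injective; toℕ<n)
open import Data.List using (List; []; _∷_; map; _++_)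
open import Data.Product using (_×_; _,_; ∃; proj₁; proj₂)
open import Data.Product.Properties using (,-injectiveˡ; ,-injectiveʳ-UIP)
open import Data.Empty using (⊥-elim)
open import Function using (_∘_; _∋_)
open import Function.Definitions using (Injective)
open import Axiom.UniquenessOfIdentityProofs using (module Decidable⇒UIP)
open import Relation.Binary.Definitions using (DecidableEquality)
open import Relation.Binary.PropositionalEquality
open import Relation.Nullary using (¬_; Dec; yes; no)

shift : ∀ {t} → ℕ → Fin t → Fin t
shift zero    a = a
shift (suc n) a = sucMod (shift n a)

toℕ-shift : ∀ {t} n (a : Fin (suc t)) → toℕ (shift n a) ≡ (toℕ a + n) % suc t
toℕ-shift {t} zero a = begin
  toℕ a               ≡⟨ sym (m<n⇒m%n≡m (toℕ<n a)) ⟩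
  toℕ a % suc t       ≡⟨ cong (_% suc t) (sym (+-identityʳ (toℕ a))) ⟩
  (toℕ a + 0) % suc t ∎
  where open ≡-Reasoning
toℕ-shift {t} (suc n) a = begin
  toℕ (sucMod (shift n a))                ≡⟨ toℕ-fromℕ< (m%n<n (suc (toℕ (shift n a))) (suc t)) ⟩
  (1 + toℕ (shift n a)) % suc t           ≡⟨ cong (λ z → (1 + z) % suc t) (toℕ-shift n a) ⟩
  (1 + (toℕ a + n) % suc t) % suc t       ≡⟨ %-distribˡ-+ 1 ((toℕ a + n) % suc t) (suc t) ⟩
  (1 % suc t + (toℕ a + n) % suc t % suc t) % suc t
    ≡⟨ cong (λ z → (1 % suc t + z) % suc t) (m%n%n≡m%n (toℕ a + n) (suc t)) ⟩
  (1 % suc t + (toℕ a + n) % suc t) % suc t ≡⟨ sym (%-distribˡ-+ 1 (toℕ a + n) (suc t)) ⟩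
  (1 + (toℕ a + n)) % suc t               ≡⟨ cong (_% suc t) (sym (+-suc (toℕ a) n)) ⟩
  (toℕ a + suc n) % suc t                 ∎
  where open ≡-Reasoning

shift-+ : ∀ {t} m n (a : Fin t) → shift m (shift n a) ≡ shift (m + n) a
shift-+ zero    n a = refl
shift-+ (suc m) n a = cong sucMod (shift-+ m n a)

shift-period : ∀ {t} (a : Fin t) → shift t a ≡ a
shift-period {suc t} a = toℕ-injective (begin
  toℕ (shift (suc t) a)     ≡⟨ toℕ-shift (suc t) a ⟩
  (toℕ a + suc t) % suc t   ≡⟨ [m+n]%n≡m%n (toℕ a) (suc t) ⟩
  toℕ a % suc t             ≡⟨ m<n⇒m%n≡m (toℕ<n a) ⟩
  toℕ a                     ∎)
  where open ≡-Reasoning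

EqualDiagonal⇒shift-invariant : ∀ {t} {M : Fin t → Fin t → ℕ} → EqualDiagonal M →
  ∀ n a b → M (shift n a) (shift n b) ≡ M a b
EqualDiagonal⇒shift-invariant M-diag zero    a b = refl
EqualDiagonal⇒shift-invariant M-diag (suc n) a b =
  trans (sym (M-diag (shift n a) (shift n b))) (EqualDiagonal⇒shift-invariant M-diag n a b)

rotate : ∀ {t} → Fin t → Fin t → Fin t
rotate m = shift (toℕ m)

unrotate : ∀ {t} → Fin t → Fin t → Fin t
unrotate {t} m = shift (t ∸ toℕ m)

rotate-comm : ∀ {t} (m a : Fin t) → rotate m a ≡ rotate a m
rotate-comm {suc t} m a = toℕ-injective (begin
  toℕ (rotate m a)          ≡⟨ toℕ-shift (toℕ m) a ⟩
  (toℕ a + toℕ m) % suc t   ≡⟨ cong (_% suc t) (+-comm (toℕ a) (toℕ m)) ⟩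
  (toℕ m + toℕ a) % suc t   ≡⟨ sym (toℕ-shift (toℕ a) m) ⟩
  toℕ (rotate a m)          ∎)
  where open ≡-Reasoning

rotate-unrotate : ∀ {t} (m a : Fin t) → rotate m (unrotate m a) ≡ a
rotate-unrotate {t} m a = begin
  shift (toℕ m) (shift (t ∸ toℕ m) a) ≡⟨ shift-+ (toℕ m) (t ∸ toℕ m) a ⟩
  shift (toℕ m + (t ∸ toℕ m)) a       ≡⟨ cong (λ n → shift n a) (m+[n∸m]≡n (<⇒≤ (toℕ<n m))) ⟩
  shift t a                           ≡⟨ shift-period a ⟩
  a                                   ∎
  where open ≡-Reasoning

unrotate-rotate : ∀ {t} (m a : Fin t) → unrotate m (rotate m a) ≡ a
unrotate-rotate {t} m a = begin
  shift (t ∸ toℕ m) (shift (toℕ m) a) ≡⟨ shift-+ (t ∸ toℕ m) (toℕ m) a ⟩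
  shift (t ∸ toℕ m + toℕ m) a         ≡⟨ cong (λ n → shift n a) (+-comm (t ∸ toℕ m) (toℕ m)) ⟩
  shift (toℕ m + (t ∸ toℕ m)) a       ≡⟨ cong (λ n → shift n a) (m+[n∸m]≡n (<⇒≤ (toℕ<n m))) ⟩
  shift t a                           ≡⟨ shift-period a ⟩
  a                                   ∎
  where open ≡-Reasoning

module _ {A C : Set} (_≟_ : DecidableEquality C) where

  countCol-++ : (c : A → C) (k : C) (xs ys : List A) →
    countCol _≟_ c k (xs ++ ys) ≡ countCol _≟_ c k xs + countCol _≟_ c k ys
  countCol-++ c k []       ys = refl
  countCol-++ c k (x ∷ xs) ys with c x ≟ k
  ... | yes _ = cong suc (countCol-++ c k xs ys)
  ... | no  _ = countCol-++ c k xs ys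

  countCol-absent : (c : A → C) (k : C) (xs : List A) → (∀ x → ¬ c x ≡ k) →
    countCol _≟_ c k xs ≡ 0
  countCol-absent c k []       _    = refl
  countCol-absent c k (x ∷ xs) c≢k with c x ≟ k
  ... | yes p = ⊥-elim (c≢k x p)
  ... | no  _ = countCol-absent c k xs c≢k

module _ {A B C : Set} (_≟_ : DecidableEquality C) where

  countCol-map : (φ : A → B) (c : B → C) (k : C) (xs : List A) →
    countCol _≟_ c k (map φ xs) ≡ countCol _≟_ (c ∘ φ) k xs
  countCol-map φ c k []       = refl
  countCol-map φ c k (x ∷ xs) with c (φ x) ≟ k
  ... | yes _ = cong suc (countCol-map φ c k xs)
  ... | no  _ = countCol-map φ c k xs

module _ {A C D : Set} (_≟C_ : DecidableEquality C) (_≟D_ : DecidableEquality D) where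

  countCol-fibres : (c : A → C) (k : C) (c' : A → D) (k' : D) →
    (∀ x → c x ≡ k → c' x ≡ k') → (∀ x → c' x ≡ k' → c x ≡ k) →
    (xs : List A) → countCol _≟C_ c k xs ≡ countCol _≟D_ c' k' xs
  countCol-fibres c k c' k' to from [] = refl
  countCol-fibres c k c' k' to from (x ∷ xs) with c x ≟C k | c' x ≟D k'
  ... | yes _ | yes _ = cong suc (countCol-fibres c k c' k' to from xs)
  ... | no  _ | no  _ = countCol-fibres c k c' k' to from xs
  ... | yes p | no  q = ⊥-elim (q (to x p))
  ... | no  p | yes q = ⊥-elim (p (from x q))

  countCol-∘-injective : (φ : C → D) → Injective _≡_ _≡_ φ →
    (c : A → C) (k : C) (xs : List A) →
    countCol _≟D_ (φ ∘ c) (φ k) xs ≡ countCol _≟C_ c k xs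
  countCol-∘-injective φ φ-inj c k =
    sym ∘ countCol-fibres c k (φ ∘ c) (φ k) (λ _ → cong φ) (λ _ → φ-inj)

module _ {A C : Set} (_≟_ : DecidableEquality C) where

  countCol-cong : {c c' : A → C} → (∀ x → c x ≡ c' x) →
    (k : C) (xs : List A) → countCol _≟_ c k xs ≡ countCol _≟_ c' k xs
  countCol-cong c≗c' k = countCol-fibres _≟_ _≟_ _ k _ k
    (λ x → trans (sym (c≗c' x))) (λ x → trans (c≗c' x))

  countCol-∘-inverse : (σ τ : C → C) → (∀ k → σ (τ k) ≡ k) → (∀ p → τ (σ p) ≡ p) →
    (c : A → C) (k : C) (xs : List A) →
    countCol _≟_ (σ ∘ c) k xs ≡ countCol _≟_ c (τ k) xs
  countCol-∘-inverse σ τ στ τσ c k = countCol-fibres _≟_ _≟_ (σ ∘ c) k c (τ k)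
    (λ x σcx≡k → trans (sym (τσ (c x))) (cong τ σcx≡k))
    (λ x cx≡τk → trans (cong σ cx≡τk) (στ k))

countCol-prodNbrs : (G H : Graph) {C : Set} (_≟_ : DecidableEquality C)
  (c : V G × V H → C) (k : C) (x : V G) (y : V H) →
  countCol _≟_ c k (prodNbrs G H (x , y))
    ≡ countCol _≟_ (λ y' → c (x , y')) k (nbrs H y) + countCol _≟_ (λ x' → c (x' , y)) k (nbrs G x)
countCol-prodNbrs G H _≟_ c k x y = begin
  countCol _≟_ c k (map (x ,_) (nbrs H y) ++ map (_, y) (nbrs G x))
    ≡⟨ countCol-++ _≟_ c k (map (x ,_) (nbrs H y)) (map (_, y) (nbrs G x)) ⟩
  countCol _≟_ c k (map (x ,_) (nbrs H y)) + countCol _≟_ c k (map (_, y) (nbrs G x))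
    ≡⟨ cong₂ _+_ (countCol-map _≟_ (x ,_) c k (nbrs H y)) (countCol-map _≟_ (_, y) c k (nbrs G x)) ⟩
  countCol _≟_ (λ y' → c (x , y')) k (nbrs H y) + countCol _≟_ (λ x' → c (x' , y)) k (nbrs G x) ∎
  where open ≡-Reasoning

isPerfectColoring-∘-automorphism : {V C : Set} {nb : V → List V} {_≟_ : DecidableEquality C}
  {c : V → C} {S : C → C → ℕ} (σ τ : C → C) →
  (∀ k → σ (τ k) ≡ k) → (∀ p → τ (σ p) ≡ p) → (∀ p q → S (σ p) (σ q) ≡ S p q) →
  IsPerfectColoring nb _≟_ c S → IsPerfectColoring nb _≟_ (σ ∘ c) S
isPerfectColoring-∘-automorphism {nb = nb} {_≟_} {c} {S} σ τ στ τσ S-inv (c-surj , c-perf) =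
  σc-surj , σc-perf
  where
  σc-surj : ∀ k → ∃ λ v → ∀ {w} → w ≡ v → σ (c w) ≡ k
  σc-surj k with c-surj (τ k)
  ... | v , cv≡τk = v , λ w≡v → trans (cong σ (cv≡τk w≡v)) (στ k)

  σc-perf : ∀ v k → countCol _≟_ (σ ∘ c) k (nb v) ≡ S (σ (c v)) k
  σc-perf v k = begin
    countCol _≟_ (σ ∘ c) k (nb v)  ≡⟨ countCol-∘-inverse _≟_ σ τ στ τσ c k (nb v) ⟩
    countCol _≟_ c (τ k) (nb v)    ≡⟨ c-perf v (τ k) ⟩
    S (c v) (τ k)                  ≡⟨ sym (S-inv (c v) (τ k)) ⟩
    S (σ (c v)) (σ (τ k))          ≡⟨ cong (S (σ (c v))) (στ k) ⟩
    S (σ (c v)) k                  ∎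
    where open ≡-Reasoning

isPerfectColoring-rotate : ∀ {t} {V : Set} {nb : V → List V} {c : V → Fin t} {B : Fin t → Fin t → ℕ} →
  EqualDiagonal B → (m : Fin t) →
  IsPerfectColoring nb _≟F_ c B → IsPerfectColoring nb _≟F_ (rotate m ∘ c) B
isPerfectColoring-rotate {nb = nb} {c} {B} B-diag m =
  isPerfectColoring-∘-automorphism {nb = nb} {_≟F_} {c} {B} (rotate m) (unrotate m)
  (rotate-unrotate m) (unrotate-rotate m) (EqualDiagonal⇒shift-invariant B-diag (toℕ m))

module _ {l : ℕ} {ks : Fin l → ℕ} where

  rotateCol : ((i : Fin l) → Fin (ks i)) → Col ks → Col ks
  rotateCol r (i , j) = i , rotate (r i) j

  unrotateCol : ((i : Fin l) → Fin (ks i)) → Col ks → Col ks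
  unrotateCol r (i , j) = i , unrotate (r i) j

  rotateCol-unrotateCol : ∀ r p → rotateCol r (unrotateCol r p) ≡ p
  rotateCol-unrotateCol r (i , j) = cong (i ,_) (rotate-unrotate (r i) j)

  unrotateCol-rotateCol : ∀ r p → unrotateCol r (rotateCol r p) ≡ p
  unrotateCol-rotateCol r (i , j) = cong (i ,_) (unrotate-rotate (r i) j)

  blockRotate-invariant : (S : Col ks → Col ks → ℕ) →
    (∀ i → EqualDiagonal (Block ks S i i)) →
    (∀ i i' → ¬ i ≡ i' → ∃ λ a → ∀ j j' → Block ks S i i' j j' ≡ a) →
    ∀ r p q → S (rotateCol r p) (rotateCol r q) ≡ S p q
  blockRotate-invariant S S-diag S-const r (i , j) (i' , j') with i ≟F i'
  ... | yes refl = EqualDiagonal⇒shift-invariant (S-diag i) (toℕ (r i)) j j'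
  ... | no  i≢i' with S-const i i' i≢i'
  ...   | a , block≡a = trans (block≡a _ _) (sym (block≡a j j'))

  addDiag-diagonal : ∀ S B i j j' → addDiag ks S B (i , j) (i , j') ≡ S (i , j) (i , j') + B i j j'
  addDiag-diagonal S B i j j' with i ≟F i
  ... | yes refl = refl
  ... | no  i≢i  = ⊥-elim (i≢i refl)

  addDiag-offDiagonal : ∀ S B {i i'} → ¬ i ≡ i' → ∀ j j' → addDiag ks S B (i , j) (i' , j') ≡ S (i , j) (i' , j')
  addDiag-offDiagonal S B {i} {i'} i≢i' j j' with i ≟F i'
  ... | yes i≡i' = ⊥-elim (i≢i' i≡i')
  ... | no  _    = refl

  ,-injectiveʳ-Col : ∀ {i} → Injective _≡_ _≡_ (λ (j : Fin (ks i)) → (Col ks ∋ (i , j)))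
  ,-injectiveʳ-Col = ,-injectiveʳ-UIP (Decidable⇒UIP.≡-irrelevant _≟F_)

module ProductColoring
  (G H : Graph) {l : ℕ} {ks : Fin l → ℕ}
  (g : V G → Col ks) (S : Col ks → Col ks → ℕ)
  (g-perfect : IsPerfectColoring (nbrs G) _≟Col_ g S)
  (S-diag : ∀ i → EqualDiagonal (Block ks S i i))
  (S-const : ∀ i i' → ¬ i ≡ i' → ∃ λ a → ∀ j j' → Block ks S i i' j j' ≡ a)
  (h : (i : Fin l) → V H → Fin (ks i))
  (B : (i : Fin l) → Fin (ks i) → Fin (ks i) → ℕ)
  (h-perfect : ∀ i → IsPerfectColoring (nbrs H) _≟F_ (h i) (B i))
  (B-diag : ∀ i → EqualDiagonal (B i))
  where

  rotateAt : V H → Col ks → Col ks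
  rotateAt y = rotateCol (λ i → h i y)

  f : V G × V H → Col ks
  f (x , y) = rotateAt y (g x)

  f-horizontal : ∀ y → IsPerfectColoring (nbrs G) _≟Col_ (λ x → f (x , y)) S
  f-horizontal y = isPerfectColoring-∘-automorphism {nb = nbrs G} {_≟Col_} {g} {S} (rotateAt y) (unrotateCol r)
    (rotateCol-unrotateCol r) (unrotateCol-rotateCol r) (blockRotate-invariant S S-diag S-const r)
    g-perfect
    where r = λ i → h i y

  vertical-≢ : ∀ y i j i' c → ¬ i ≡ i' →
    countCol _≟Col_ (λ y' → rotateAt y' (i , j)) (i' , c) (nbrs H y) ≡ 0
  vertical-≢ y i j i' c i≢i' =
    countCol-absent _≟Col_ _ (i' , c) (nbrs H y) (λ _ → i≢i' ∘ ,-injectiveˡ)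

  vertical-≡ : ∀ y i j c →
    countCol _≟Col_ (λ y' → rotateAt y' (i , j)) (i , c) (nbrs H y) ≡ B i (rotate (h i y) j) c
  vertical-≡ y i j c = begin
    countCol _≟Col_ (λ y' → i , rotate (h i y') j) (i , c) (nbrs H y)
      ≡⟨ countCol-cong _≟Col_ (λ y' → cong (i ,_) (rotate-comm (h i y') j)) (i , c) (nbrs H y) ⟩
    countCol _≟Col_ ((i ,_) ∘ rotate j ∘ h i) (i , c) (nbrs H y)
      ≡⟨ countCol-∘-injective _≟F_ _≟Col_ (i ,_) ,-injectiveʳ-Col (rotate j ∘ h i) c (nbrs H y) ⟩
    countCol _≟F_ (rotate j ∘ h i) c (nbrs H y)
      ≡⟨ proj₂ (isPerfectColoring-rotate {nb = nbrs H} {c = h i} (B-diag i) j (h-perfect i)) y c ⟩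
    B i (rotate j (h i y)) c
      ≡⟨ cong (λ a → B i a c) (rotate-comm j (h i y)) ⟩
    B i (rotate (h i y) j) c ∎
    where open ≡-Reasoning

  vertical+horizontal : ∀ y p k →
    countCol _≟Col_ (λ y' → rotateAt y' p) k (nbrs H y) + S (rotateAt y p) k
      ≡ addDiag ks S B (rotateAt y p) k
  vertical+horizontal y (i , j) (i' , c) = by-cases (i ≟F i')
    where
    -- not a with-abstraction: i ≟F i' also occurs inside _≟Col_ in the goal
    by-cases : Dec (i ≡ i') →
      countCol _≟Col_ (λ y' → rotateAt y' (i , j)) (i' , c) (nbrs H y) + S (rotateAt y (i , j)) (i' , c)
        ≡ addDiag ks S B (rotateAt y (i , j)) (i' , c)
    by-cases (yes refl) = begin
      countCol _≟Col_ (λ y' → rotateAt y' (i , j)) (i , c) (nbrs H y) + S (rotateAt y (i , j)) (i , c)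
        ≡⟨ cong (_+ S (rotateAt y (i , j)) (i , c)) (vertical-≡ y i j c) ⟩
      B i (rotate (h i y) j) c + S (rotateAt y (i , j)) (i , c)
        ≡⟨ +-comm (B i (rotate (h i y) j) c) _ ⟩
      S (rotateAt y (i , j)) (i , c) + B i (rotate (h i y) j) c
        ≡⟨ sym (addDiag-diagonal S B i (rotate (h i y) j) c) ⟩
      addDiag ks S B (rotateAt y (i , j)) (i , c) ∎
      where open ≡-Reasoning
    by-cases (no i≢i') = trans (cong (_+ S (rotateAt y (i , j)) (i' , c)) (vertical-≢ y i j i' c i≢i'))
                               (sym (addDiag-offDiagonal S B i≢i' _ c))

  f-perfect : IsPerfectColoring (prodNbrs G H) _≟Col_ f (addDiag ks S B)
  f-perfect = f-surjective , f-count
    where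
    f-surjective : ∀ k → ∃ λ v → ∀ {w} → w ≡ v → f w ≡ k
    f-surjective (i , c) with proj₁ (h-perfect i) c
    ... | y , _ with proj₁ (f-horizontal y) (i , c)
    ...   | x , fxy≡k = (x , y) , λ { refl → fxy≡k refl }

    f-count : ∀ v k → countCol _≟Col_ f k (prodNbrs G H v) ≡ addDiag ks S B (f v) k
    f-count (x , y) k = begin
      countCol _≟Col_ f k (prodNbrs G H (x , y))
        ≡⟨ countCol-prodNbrs G H _≟Col_ f k x y ⟩
      countCol _≟Col_ (λ y' → f (x , y')) k (nbrs H y) + countCol _≟Col_ (λ x' → f (x' , y)) k (nbrs G x)
        ≡⟨ cong (countCol _≟Col_ (λ y' → f (x , y')) k (nbrs H y) +_) (proj₂ (f-horizontal y) x k) ⟩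
      countCol _≟Col_ (λ y' → f (x , y')) k (nbrs H y) + S (f (x , y)) k
        ≡⟨ vertical+horizontal y (g x) k ⟩
      addDiag ks S B (f (x , y)) k ∎
      where open ≡-Reasoning

theorem2 : (G H : Graph) (l : ℕ) (ks : Fin l → ℕ) → (∀ i → 0 < ks i) →
    (g : V G → Col ks) (S : Col ks → Col ks → ℕ) →
    IsPerfectColoring (nbrs G) _≟Col_ g S →
    (∀ i → EqualDiagonal (Block ks S i i)) →
    (∀ i i' → ¬ i ≡ i' → ∃ λ a → ∀ j j' → Block ks S i i' j j' ≡ a) →
    (h : (i : Fin l) → V H → Fin (ks i)) →
    (B : (i : Fin l) → Fin (ks i) → Fin (ks i) → ℕ) →
    (∀ i → IsPerfectColoring (nbrs H) _≟F_ (h i) (B i)) →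
    (∀ i → EqualDiagonal (B i)) →
    ∃ λ (f : V G × V H → Col ks) →
      IsPerfectColoring (prodNbrs G H) _≟Col_ f (addDiag ks S B)
theorem2 G H l ks _ g S g-perfect S-diag S-const h B h-perfect B-diag =
  f , f-perfect
  where open ProductColoring G H g S g-perfect S-diag S-const h B h-perfect B-diag
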